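{- Let $P\subset\Sigma\times\Sigma\times\Sigma$ be a promise tensor with non-maximal asymptotic subrank $\limsup_{N\to\infty}\alpha(P^{\otimes N})^{1/N}<|\Sigma|$. Then for every permutation problem $I\subset P$ we have $\mathrm{cc}((I,P)^{\otimes N})\ge\Omega(N)$.
   Context: A promise problem is $I\subset P\subset\Sigma^3$; players receive $a,b,c$ with $(a,b,c)\in P$ and decide whether $(a,b,c)\in I$; $\mathrm{cc}$ is deterministic communication complexity in the shared-blackboard model (players in cyclic order append bits depending on own input and board, or accept/reject; input accepted iff all accept; correctness only on $P$; cost = maximum bits written). $(I,P)$ is a permutation problem if for each $a\in\Sigma$ there is at most one $(b,c)$ with $(a,b,c)\in I$, likewise for the other two coordinates, and $|I|=|\Sigma|$. $(I,P)^{\otimes N}$ is the problem with promise $P^{\otimes N}=\{(A,B,C)\in(\Sigma^N)^3:(A_i,B_i,C_i)\in P\ \forall i\}$ and accepting set $I^{\otimes N}$ defined analogously. For $Q\subset A\times B\times C$, $\alpha(Q)$ is the largest size of $S\subset Q$ such that each element of $\pi_1(S)$ (resp. $\pi_2(S),\pi_3(S)$) lies in exactly one triple of $S$ and $Q\cap(\pi_1(S)\times\pi_2(S)\times\pi_3(S))=S$ (the zeroing-out subrank), with $\pi_i$ coordinate projections. -}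

module Defs where

open import Data.Nat using (ℕ; zero; suc; _+_; _*_; _^_; _≤_; _<_; _⊔_)
open import Data.Bool using (Bool; true; false; _∧_)
open import Data.Fin using (Fin)
open import Data.Vec using (Vec; lookup)
open import Data.Product using (Σ; _×_; _,_; ∃)
open import Relation.Binary.PropositionalEquality using (_≡_)
open import Function.Bundles using (_⤖_)

-- A tripartite relation ("tensor") on Σ × Σ × Σ with Σ = Fin n, given by a
-- Boolean indicator.
Tri : ℕ → Set
Tri n = Fin n → Fin n → Fin n → Bool

Triples : ∀ {n} → Tri n → Set
Triples {n} T = Σ (Fin n) λ a → Σ (Fin n) λ b → Σ (Fin n) λ c → T a b c ≡ true

_⊆T_ : ∀ {n} → Tri n → Tri n → Set
_⊆T_ {n} I P = ∀ (a b c : Fin n) → I a b c ≡ true → P a b c ≡ true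

IsPermutationProblem : ∀ {n} → Tri n → Set
IsPermutationProblem {n} I =
  (∀ a b c b' c' → I a b c ≡ true → I a b' c' ≡ true → (b ≡ b') × (c ≡ c')) ×
  (∀ a b c a' c' → I a b c ≡ true → I a' b c' ≡ true → (a ≡ a') × (c ≡ c')) ×
  (∀ a b c a' b' → I a b c ≡ true → I a' b' c ≡ true → (a ≡ a') × (b ≡ b')) ×
  (Fin n ⤖ Triples I)

Word : ℕ → ℕ → Set
Word n N = Vec (Fin n) N

TensorPow : ∀ {n} → Tri n → (N : ℕ) → Word n N → Word n N → Word n N → Set
TensorPow T N A B C = ∀ (i : Fin N) → T (lookup A i) (lookup B i) (lookup C i) ≡ true

-- A set S ⊆ Q of size m in which each element of π₁(S), π₂(S), π₃(S) lies in
-- exactly one triple of S is the same as an enumeration i ↦ (x i, y i, z i)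
-- of S by Fin m with x, y, z injective; the condition
-- Q ∩ (π₁(S) × π₂(S) × π₃(S)) = S reads: Q (x i) (y j) (z k) → i = j = k.
IsZeroingOut : {X : Set} → (X → X → X → Set) → (m : ℕ) →
               (Fin m → X) → (Fin m → X) → (Fin m → X) → Set
IsZeroingOut {X} Q m x y z =
  (∀ i → Q (x i) (y i) (z i)) ×
  (∀ i j → x i ≡ x j → i ≡ j) ×
  (∀ i j → y i ≡ y j → i ≡ j) ×
  (∀ i j → z i ≡ z j → i ≡ j) ×
  (∀ i j k → Q (x i) (y j) (z k) → (i ≡ j) × (j ≡ k))

HasZeroingOut : {X : Set} → (X → X → X → Set) → ℕ → Set
HasZeroingOut {X} Q m =
  Σ (Fin m → X) λ x → Σ (Fin m → X) λ y → Σ (Fin m → X) λ z → IsZeroingOut Q m x y z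

SubrankAtMost : {X : Set} → (X → X → X → Set) → ℕ → Set
SubrankAtMost Q r = ∀ m → HasZeroingOut Q m → m ≤ r

-- limsup_{N→∞} α(P^{⊗N})^{1/N} < n, stated without reals:
-- there is a rational p/q < n with α(P^{⊗N}) ≤ (p/q)^N for all large N.
NonMaximalAsymptoticSubrank : ∀ {n} → Tri n → Set
NonMaximalAsymptoticSubrank {n} P =
  Σ ℕ λ p → Σ ℕ λ q → (1 ≤ q) × (p < q * n) ×
  Σ ℕ λ N₀ → ∀ N → N₀ ≤ N →
    ∀ m → HasZeroingOut (TensorPow P N) m → m * q ^ N ≤ p ^ N

-- A node is either a halting node (determined by the board, i.e. by the path
-- from the root), at which each player accepts/rejects as a function of its
-- own input, or a speaking node, at which the player whose turn it is writes
-- a bit depending on its own input (and the board = the path so far).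
data Protocol (X : Set) : Set where
  halt  : (X → Bool) → (X → Bool) → (X → Bool) → Protocol X
  speak : (X → Bool) → (Bool → Protocol X) → Protocol X

cost : ∀ {X} → Protocol X → ℕ
cost (halt _ _ _) = 0
cost (speak _ k) = suc (cost (k false) ⊔ cost (k true))

data Player : Set where
  p₁ p₂ p₃ : Player

next : Player → Player
next p₁ = p₂
next p₂ = p₃
next p₃ = p₁

inputOf : ∀ {X : Set} → Player → X → X → X → X
inputOf p₁ a b c = a
inputOf p₂ a b c = b
inputOf p₃ a b c = c

runFrom : ∀ {X} → Player → Protocol X → X → X → X → Bool
runFrom _ (halt f g h) a b c = f a ∧ g b ∧ h c
runFrom t (speak f k) a b c = runFrom (next t) (k (f (inputOf t a b c))) a b c

run : ∀ {X} → Protocol X → X → X → X → Bool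
run = runFrom p₁

Solves : ∀ {n} → Tri n → Tri n → (N : ℕ) → Protocol (Word n N) → Set
Solves I P N π = ∀ A B C → TensorPow P N A B C →
  (run π A B C ≡ true → TensorPow I N A B C) ×
  (TensorPow I N A B C → run π A B C ≡ true)

CCAtLeast : ∀ {n} → Tri n → Tri n → (N : ℕ) → ℕ → Set
CCAtLeast I P N d = ∀ π → Solves I P N π → d ≤ cost π

module Submission where

-- A protocol of cost c splits the inputs into at most 2^c leaves, and at each
-- leaf the accepted inputs form a combinatorial rectangle.  Enumerate I as
-- s ↦ (X s, Y s, Z s) and consider the n^N words (X a, Y a, Z a), a ∈ Σ^N.
-- A correct protocol accepts all of them, while on promise inputs
-- (X a, Y b, Z c) it accepts only if a = b = c, since I is a permutation
-- problem.  Hence the diagonal words reaching one leaf form a zeroing-out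
-- of P^{⊗N}, of size at most (p/q)^N.  So (qn)^N ≤ 2^c p^N, while Bernoulli's
-- inequality gives a k with 2 p^k ≤ (qn)^k, whence 2^c p^N < (qn)^N once N > kc.

open import Defs
open import Data.Nat using (ℕ; zero; suc; _+_; _*_; _^_; _∸_; _≤_; _<_; _⊔_; z≤n; s≤s; NonZero; >-nonZero)
open import Data.Nat.Properties hiding (_≟_)
open import Data.Nat.Tactic.RingSolver using (solve-∀)
open import Data.Bool using (Bool; true; false; _∧_; _≟_)
open import Data.Fin using (Fin; finToFun; funToFin; combine)
import Data.Fin as Fin
open import Data.Fin.Properties using (funToFin-finToFin)
open import Data.Vec using (lookup; tabulate)
open import Data.Vec.Properties using (lookup∘tabulate)
open import Data.List using (List; []; _∷_; length; filter; allFin)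
import Data.List as List
open import Data.List.Properties using (length-tabulate)
open import Data.List.Membership.Propositional using (_∈_)
open import Data.List.Membership.Propositional.Properties using (∈-lookup; ∈-filter⁻)
open import Data.List.Relation.Unary.Unique.Propositional using (Unique)
open import Data.List.Relation.Unary.Unique.Propositional.Properties using (filter⁺; allFin⁺)
open import Data.List.Relation.Unary.AllPairs using (_∷_)
import Data.List.Relation.Unary.All as All
open import Data.Product using (Σ; ∃-syntax; _×_; _,_; proj₁; proj₂)
open import Data.Empty using (⊥-elim)
open import Function using (_∘_)
open import Function.Bundles using (Bijection)
open import Function.Definitions using (Injective)
open import Relation.Binary.PropositionalEquality
open import Relation.Nullary using (Dec)
open import Axiom.UniquenessOfIdentityProofs using (module Decidable⇒UIP)

^-distribʳ-* : ∀ m n o → (m * n) ^ o ≡ m ^ o * n ^ o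
^-distribʳ-* m n zero = refl
^-distribʳ-* m n (suc o) rewrite ^-distribʳ-* m n o = interchange m n (m ^ o) (n ^ o)
  where
    interchange : ∀ a b A B → a * b * (A * B) ≡ a * A * (b * B)
    interchange = solve-∀

suc-^-bernoulli : ∀ p j → p ^ j * (p + j) ≤ suc p ^ j * p
suc-^-bernoulli p zero = ≤-reflexive (cong (1 *_) (+-identityʳ p))
suc-^-bernoulli p (suc j) = begin
    p * p ^ j * (p + suc j)                ≤⟨ m≤m+n _ (p ^ j * j) ⟩
    p * p ^ j * (p + suc j) + p ^ j * j    ≡⟨ regroup p (p ^ j) j ⟩
    suc p * (p ^ j * (p + j))              ≤⟨ *-monoʳ-≤ (suc p) (suc-^-bernoulli p j) ⟩
    suc p * (suc p ^ j * p)                ≡⟨ sym (*-assoc (suc p) (suc p ^ j) p) ⟩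
    suc p ^ suc j * p                      ∎
  where
    open ≤-Reasoning
    regroup : ∀ p A j → p * A * (p + suc j) + A * j ≡ suc p * (A * (p + j))
    regroup = solve-∀

doubling-exponent : ∀ {p r} → p < r → ∃[ k ] 2 * p ^ k ≤ r ^ k
doubling-exponent {zero} p<r = 1 , z≤n
doubling-exponent {p@(suc _)} {r} p<r = p , ≤-trans two-p^p≤suc-p^p (^-monoˡ-≤ p p<r)
  where
    two-p^p≤suc-p^p : 2 * p ^ p ≤ suc p ^ p
    two-p^p≤suc-p^p = *-cancelˡ-≤ p (begin
      p * (2 * p ^ p)    ≡⟨ double p (p ^ p) ⟩
      p ^ p * (p + p)    ≤⟨ suc-^-bernoulli p p ⟩
      suc p ^ p * p      ≡⟨ *-comm (suc p ^ p) p ⟩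
      p * suc p ^ p      ∎)
      where
        open ≤-Reasoning
        double : ∀ p A → p * (2 * A) ≡ A * (p + p)
        double = solve-∀

exponential-gap : ∀ {p r} k c {N} → 2 * p ^ k ≤ r ^ k → p < r → k * c < N →
                  2 ^ c * p ^ N < r ^ N
exponential-gap {p} {r} k c {N} 2p^k≤r^k p<r kc<N = begin-strict
  2 ^ c * p ^ N                  ≡⟨ cong (λ e → 2 ^ c * p ^ e) (sym N≡kc+d) ⟩
  2 ^ c * p ^ (k * c + d)        ≡⟨ cong (2 ^ c *_) (^-distribˡ-+-* p (k * c) d) ⟩
  2 ^ c * (p ^ (k * c) * p ^ d)  ≡⟨ sym (*-assoc (2 ^ c) (p ^ (k * c)) (p ^ d)) ⟩
  2 ^ c * p ^ (k * c) * p ^ d    ≤⟨ *-monoˡ-≤ (p ^ d) head-bound ⟩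
  r ^ (k * c) * p ^ d            <⟨ *-monoʳ-< (r ^ (k * c)) {{m^n≢0 r (k * c)}} (^-monoˡ-< d p<r) ⟩
  r ^ (k * c) * r ^ d            ≡⟨ sym (^-distribˡ-+-* r (k * c) d) ⟩
  r ^ (k * c + d)                ≡⟨ cong (r ^_) N≡kc+d ⟩
  r ^ N                          ∎
  where
    open ≤-Reasoning
    d : ℕ
    d = N ∸ k * c
    N≡kc+d : k * c + d ≡ N
    N≡kc+d = m+[n∸m]≡n (<⇒≤ kc<N)
    instance
      d≢0 : NonZero d
      d≢0 = >-nonZero (m<n⇒0<n∸m kc<N)
      r≢0 : NonZero r
      r≢0 = >-nonZero (≤-trans (s≤s z≤n) p<r)
    head-bound : 2 ^ c * p ^ (k * c) ≤ r ^ (k * c)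
    head-bound = begin
      2 ^ c * p ^ (k * c)   ≡⟨ cong (2 ^ c *_) (sym (^-*-assoc p k c)) ⟩
      2 ^ c * (p ^ k) ^ c   ≡⟨ sym (^-distribʳ-* 2 (p ^ k) c) ⟩
      (2 * p ^ k) ^ c       ≤⟨ ^-monoˡ-≤ c 2p^k≤r^k ⟩
      (r ^ k) ^ c           ≡⟨ ^-*-assoc r k c ⟩
      r ^ (k * c)           ∎

lookup-injective : ∀ {A : Set} {xs : List A} → Unique xs →
                   ∀ {i j} → List.lookup xs i ≡ List.lookup xs j → i ≡ j
lookup-injective {xs = _ ∷ _} (_ ∷ _) {Fin.zero} {Fin.zero} _ = refl
lookup-injective {xs = _ ∷ xs} (a∉xs ∷ _) {Fin.zero} {Fin.suc j} e =
  ⊥-elim (All.lookup a∉xs (∈-lookup {xs = xs} j) e)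
lookup-injective {xs = _ ∷ xs} (a∉xs ∷ _) {Fin.suc i} {Fin.zero} e =
  ⊥-elim (All.lookup a∉xs (∈-lookup {xs = xs} i) (sym e))
lookup-injective {xs = _ ∷ _} (_ ∷ u) {Fin.suc i} {Fin.suc j} e =
  cong Fin.suc (lookup-injective u e)

∧-true : ∀ u {v : Bool} → u ∧ v ≡ true → u ≡ true × v ≡ true
∧-true true  v≡true = refl , v≡true

module DiagonalFamily {X J : Set} (Q : X → X → X → Set) (x y z : J → X)
  (x-injective : Injective _≡_ _≡_ x) (y-injective : Injective _≡_ _≡_ y)
  (z-injective : Injective _≡_ _≡_ z) (diagonal : ∀ a → Q (x a) (y a) (z a)) where

  RecognisesDiagonal : Player → Protocol X → List J → Set
  RecognisesDiagonal t π as = Unique as ×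
    (∀ {a} → a ∈ as → runFrom t π (x a) (y a) (z a) ≡ true) ×
    (∀ {a b c} → a ∈ as → b ∈ as → c ∈ as → Q (x a) (y b) (z c) →
       runFrom t π (x a) (y b) (z c) ≡ true → a ≡ b × b ≡ c)

  halt-hasZeroingOut : ∀ {t} f g h {as} → RecognisesDiagonal t (halt f g h) as →
                       HasZeroingOut Q (length as)
  halt-hasZeroingOut {t} f g h {as} (unique , accepts , rejects) =
    x ∘ at , y ∘ at , z ∘ at ,
    (λ i → diagonal (at i)) ,
    (λ i j → lookup-injective unique ∘ x-injective) ,
    (λ i j → lookup-injective unique ∘ y-injective) ,
    (λ i j → lookup-injective unique ∘ z-injective) ,
    offDiagonal
    where
      at : Fin (length as) → J
      at = List.lookup as
      member : ∀ i → at i ∈ as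
      member = ∈-lookup {xs = as}
      accepts-at : ∀ i → f (x (at i)) ≡ true × g (y (at i)) ≡ true × h (z (at i)) ≡ true
      accepts-at i with ∧-true _ (accepts (member i))
      ... | f≡true , gh≡true = f≡true , ∧-true _ gh≡true
      -- The players decide independently, so the leaf also accepts every mixed triple.
      accepts-mixed : ∀ i j k → f (x (at i)) ∧ g (y (at j)) ∧ h (z (at k)) ≡ true
      accepts-mixed i j k
        rewrite proj₁ (accepts-at i) | proj₁ (proj₂ (accepts-at j)) | proj₂ (proj₂ (accepts-at k)) = refl
      offDiagonal : ∀ i j k → Q (x (at i)) (y (at j)) (z (at k)) → i ≡ j × j ≡ k
      offDiagonal i j k q with rejects (member i) (member j) (member k) q (accepts-mixed i j k)
      ... | ai≡aj , aj≡ak = lookup-injective unique ai≡aj , lookup-injective unique aj≡ak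

  speaker-bit : Player → (X → Bool) → J → Bool
  speaker-bit t f a = f (inputOf t (x a) (y a) (z a))

  speaker-bit-mixed : ∀ t f {a b c β} →
    speaker-bit t f a ≡ β → speaker-bit t f b ≡ β → speaker-bit t f c ≡ β →
    f (inputOf t (x a) (y b) (z c)) ≡ β
  speaker-bit-mixed p₁ f fa≡β _ _ = fa≡β
  speaker-bit-mixed p₂ f _ fb≡β _ = fb≡β
  speaker-bit-mixed p₃ f _ _ fc≡β = fc≡β

  branch : Player → (X → Bool) → Bool → List J → List J
  branch t f β = filter (λ a → speaker-bit t f a ≟ β)

  length-≤-branches : ∀ t f as →
    length as ≤ length (branch t f false as) + length (branch t f true as)
  length-≤-branches t f [] = z≤n
  length-≤-branches t f (a ∷ as) with speaker-bit t f a
  ... | false = s≤s (length-≤-branches t f as)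
  ... | true  = ≤-trans (s≤s (length-≤-branches t f as)) (≤-reflexive (sym (+-suc _ _)))

  branch-recognisesDiagonal : ∀ t f k β {as} → RecognisesDiagonal t (speak f k) as →
                              RecognisesDiagonal (next t) (k β) (branch t f β as)
  branch-recognisesDiagonal t f k β {as} (unique , accepts , rejects) =
    filter⁺ bit≟β unique , accepts′ , rejects′
    where
      bit≟β : ∀ a → Dec (speaker-bit t f a ≡ β)
      bit≟β a = speaker-bit t f a ≟ β
      accepts′ : ∀ {a} → a ∈ branch t f β as → runFrom (next t) (k β) (x a) (y a) (z a) ≡ true
      accepts′ a∈ with ∈-filter⁻ bit≟β {xs = as} a∈
      ... | a∈as , refl = accepts a∈as
      rejects′ : ∀ {a b c} → a ∈ branch t f β as → b ∈ branch t f β as → c ∈ branch t f β as →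
                 Q (x a) (y b) (z c) → runFrom (next t) (k β) (x a) (y b) (z c) ≡ true →
                 a ≡ b × b ≡ c
      rejects′ {a} {b} {c} a∈ b∈ c∈ q run≡true
        with ∈-filter⁻ bit≟β {xs = as} a∈ | ∈-filter⁻ bit≟β {xs = as} b∈ | ∈-filter⁻ bit≟β {xs = as} c∈
      ... | a∈as , fa≡β | b∈as , fb≡β | c∈as , fc≡β =
        rejects a∈as b∈as c∈as q
          (subst (λ γ → runFrom (next t) (k γ) (x a) (y b) (z c) ≡ true)
                 (sym (speaker-bit-mixed t f fa≡β fb≡β fc≡β)) run≡true)

  length-≤-2^cost : ∀ {w v} → (∀ m → HasZeroingOut Q m → m * w ≤ v) →
                    ∀ {t} π {as} → RecognisesDiagonal t π as → length as * w ≤ 2 ^ cost π * v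
  length-≤-2^cost {w} {v} bound {t} (halt f g h) {as} R =
    ≤-trans (bound (length as) (halt-hasZeroingOut {t} f g h R)) (≤-reflexive (sym (+-identityʳ v)))
  length-≤-2^cost {w} {v} bound {t} (speak f k) {as} R = begin
      length as * w                          ≤⟨ *-monoˡ-≤ w (length-≤-branches t f as) ⟩
      (ℓ₀ + ℓ₁) * w                          ≡⟨ *-distribʳ-+ w ℓ₀ ℓ₁ ⟩
      ℓ₀ * w + ℓ₁ * w                        ≤⟨ +-mono-≤ (branch-bound false (m≤m⊔n c₀ c₁))
                                                         (branch-bound true (m≤n⊔m c₀ c₁)) ⟩
      2 ^ c * v + 2 ^ c * v                  ≡⟨ cong (2 ^ c * v +_) (sym (+-identityʳ (2 ^ c * v))) ⟩
      2 * (2 ^ c * v)                        ≡⟨ sym (*-assoc 2 (2 ^ c) v) ⟩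
      2 ^ suc c * v                          ∎
    where
      open ≤-Reasoning
      ℓ₀ ℓ₁ c₀ c₁ c : ℕ
      ℓ₀ = length (branch t f false as)
      ℓ₁ = length (branch t f true as)
      c₀ = cost (k false)
      c₁ = cost (k true)
      c = c₀ ⊔ c₁
      branch-bound : ∀ β → cost (k β) ≤ c → length (branch t f β as) * w ≤ 2 ^ c * v
      branch-bound β cost≤c =
        ≤-trans (length-≤-2^cost bound (k β) (branch-recognisesDiagonal t f k β R))
                (*-monoˡ-≤ v (^-monoʳ-≤ 2 cost≤c))

funToFin-cong : ∀ {m k} {f g : Fin m → Fin k} → (∀ i → f i ≡ g i) → funToFin f ≡ funToFin g
funToFin-cong {zero}  _   = refl
funToFin-cong {suc m} {f = f} {g} f≗g =
  cong₂ combine (f≗g Fin.zero) (funToFin-cong {f = f ∘ Fin.suc} {g ∘ Fin.suc} (f≗g ∘ Fin.suc))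

finToFun-injective : ∀ {n N} {a b : Fin (n ^ N)} →
                     (∀ i → finToFun {n} {N} a i ≡ finToFun b i) → a ≡ b
finToFun-injective {n} {N} {a} {b} a≗b = begin
  a                              ≡⟨ sym (funToFin-finToFin {N} {n} a) ⟩
  funToFin (finToFun {n} {N} a)  ≡⟨ funToFin-cong a≗b ⟩
  funToFin (finToFun {n} {N} b)  ≡⟨ funToFin-finToFin {N} {n} b ⟩
  b                              ∎
  where open ≡-Reasoning

module PermutationWords {n : ℕ} (I : Tri n) (perm : IsPermutationProblem I) (N : ℕ) where
  open Bijection (proj₂ (proj₂ (proj₂ perm))) using (to; injective)

  letter : Fin (n ^ N) → Fin N → Fin n
  letter = finToFun

  X Y Z : Fin n → Fin n
  X s = proj₁ (to s)
  Y s = proj₁ (proj₂ (to s))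
  Z s = proj₁ (proj₂ (proj₂ (to s)))

  I-XYZ : ∀ s → I (X s) (Y s) (Z s) ≡ true
  I-XYZ s = proj₂ (proj₂ (proj₂ (to s)))

  Triples-≡ : ∀ {u v : Triples I} → proj₁ u ≡ proj₁ v → proj₁ (proj₂ u) ≡ proj₁ (proj₂ v) →
              proj₁ (proj₂ (proj₂ u)) ≡ proj₁ (proj₂ (proj₂ v)) → u ≡ v
  Triples-≡ {a , b , c , e} {.a , .b , .c , e′} refl refl refl =
    cong (λ e → a , b , c , e) (Decidable⇒UIP.≡-irrelevant _≟_ e e′)

  X-injective : Injective _≡_ _≡_ X
  X-injective {s} {s′} Xs≡Xs′
    with proj₁ perm _ _ _ _ _ (I-XYZ s) (subst (λ a → I a (Y s′) (Z s′) ≡ true) (sym Xs≡Xs′) (I-XYZ s′))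
  ... | Ys≡Ys′ , Zs≡Zs′ = injective (Triples-≡ Xs≡Xs′ Ys≡Ys′ Zs≡Zs′)

  Y-injective : Injective _≡_ _≡_ Y
  Y-injective {s} {s′} Ys≡Ys′
    with proj₁ (proj₂ perm) _ _ _ _ _ (I-XYZ s) (subst (λ b → I (X s′) b (Z s′) ≡ true) (sym Ys≡Ys′) (I-XYZ s′))
  ... | Xs≡Xs′ , Zs≡Zs′ = injective (Triples-≡ Xs≡Xs′ Ys≡Ys′ Zs≡Zs′)

  Z-injective : Injective _≡_ _≡_ Z
  Z-injective {s} {s′} Zs≡Zs′
    with proj₁ (proj₂ (proj₂ perm)) _ _ _ _ _ (I-XYZ s) (subst (λ c → I (X s′) (Y s′) c ≡ true) (sym Zs≡Zs′) (I-XYZ s′))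
  ... | Xs≡Xs′ , Ys≡Ys′ = injective (Triples-≡ Xs≡Xs′ Ys≡Ys′ Zs≡Zs′)

  word : (Fin n → Fin n) → Fin (n ^ N) → Word n N
  word W a = tabulate (W ∘ letter a)

  lookup-word : ∀ W a i → lookup (word W a) i ≡ W (letter a i)
  lookup-word W a = lookup∘tabulate (W ∘ letter a)

  word-injective : ∀ {W} → Injective _≡_ _≡_ W → Injective _≡_ _≡_ (word W)
  word-injective {W} W-injective {a} {b} wa≡wb = finToFun-injective λ i → W-injective (begin
    W (letter a i)    ≡⟨ sym (lookup-word W a i) ⟩
    lookup (word W a) i ≡⟨ cong (λ w → lookup w i) wa≡wb ⟩
    lookup (word W b) i ≡⟨ lookup-word W b i ⟩
    W (letter b i)    ∎)
    where open ≡-Reasoning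

  word-letters : ∀ (T : Tri n) a b c i →
    T (lookup (word X a) i) (lookup (word Y b) i) (lookup (word Z c) i) ≡
    T (X (letter a i)) (Y (letter b i)) (Z (letter c i))
  word-letters T a b c i rewrite lookup-word X a i | lookup-word Y b i | lookup-word Z c i = refl

  diagonal-I : ∀ a → TensorPow I N (word X a) (word Y a) (word Z a)
  diagonal-I a i = trans (word-letters I a a a i) (I-XYZ (letter a i))

  offDiagonal-I : ∀ {a b c} → TensorPow I N (word X a) (word Y b) (word Z c) → a ≡ b × b ≡ c
  offDiagonal-I {a} {b} {c} I-abc = a≡b , trans (sym a≡b) a≡c
    where
      letters : ∀ i → Y (letter a i) ≡ Y (letter b i) × Z (letter a i) ≡ Z (letter c i)
      letters i = proj₁ perm _ _ _ _ _ (I-XYZ (letter a i))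
                    (trans (sym (word-letters I a b c i)) (I-abc i))
      a≡b : a ≡ b
      a≡b = finToFun-injective (λ i → Y-injective (proj₁ (letters i)))
      a≡c : a ≡ c
      a≡c = finToFun-injective (λ i → Z-injective (proj₂ (letters i)))

permutation-words-≤-2^cost : ∀ {n} {P I : Tri n} → I ⊆T P → IsPermutationProblem I →
  ∀ {N w v} → (∀ m → HasZeroingOut (TensorPow P N) m → m * w ≤ v) →
  ∀ π → Solves I P N π → n ^ N * w ≤ 2 ^ cost π * v
permutation-words-≤-2^cost {n} {P} {I} I⊆P perm {N} {w} {v} bound π solves =
  subst (λ ℓ → ℓ * w ≤ 2 ^ cost π * v) (length-tabulate {n = n ^ N} (λ a → a))
        (length-≤-2^cost bound π recognises)
  where
    open PermutationWords I perm N
    diagonal-P : ∀ a → TensorPow P N (word X a) (word Y a) (word Z a)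
    diagonal-P a i = I⊆P _ _ _ (diagonal-I a i)
    open DiagonalFamily (TensorPow P N) (word X) (word Y) (word Z)
      (word-injective X-injective) (word-injective Y-injective) (word-injective Z-injective) diagonal-P
    recognises : RecognisesDiagonal p₁ π (allFin (n ^ N))
    recognises =
      allFin⁺ (n ^ N) ,
      (λ {a} _ → proj₂ (solves _ _ _ (diagonal-P a)) (diagonal-I a)) ,
      (λ _ _ _ P-abc accepted → offDiagonal-I (proj₁ (solves _ _ _ P-abc) accepted))

mainTheorem11 : (n : ℕ) (P I : Tri n) →
    NonMaximalAsymptoticSubrank P →
    I ⊆T P → IsPermutationProblem I →
    Σ ℕ λ k → Σ ℕ λ N₀ → ∀ N → N₀ ≤ N →
      ∀ (π : Protocol (Word n N)) → Solves I P N π → N ≤ k * cost π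
mainTheorem11 n P I (p , q , _ , p<qn , N₀ , subrank-bound) I⊆P perm
  with k , 2p^k≤[qn]^k ← doubling-exponent p<qn =
  k , N₀ , λ N N₀≤N π solves → ≮⇒≥ λ k*cost<N →
    <⇒≱ (exponential-gap k (cost π) 2p^k≤[qn]^k p<qn k*cost<N) (counted N N₀≤N π solves)
  where
    counted : ∀ N → N₀ ≤ N → ∀ π → Solves I P N π → (q * n) ^ N ≤ 2 ^ cost π * p ^ N
    counted N N₀≤N π solves =
      subst (_≤ 2 ^ cost π * p ^ N)
            (trans (*-comm (n ^ N) (q ^ N)) (sym (^-distribʳ-* q n N)))
            (permutation-words-≤-2^cost I⊆P perm (subrank-bound N N₀≤N) π solves)
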